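{- Let $\mathbf{A}$ be a bounded residuated lattice and let $h:\mathbf{A}\to\mathbf{B}(\mathbf{A})$ be a homomorphism such that $h(h(x))=h(x)$ for all $x\in A$. If $x\le h(x)$ for all $x\in A$, then $\neg\neg x=h(x)$ for all $x\in A$.
   Context: A residuated lattice is an algebra $(A,\ast,\to,\vee,\wedge,\top)$ with $(A,\ast,\top)$ a commutative monoid, $(A,\vee,\wedge)$ a lattice with top $\top$, and $x\ast y\le z$ iff $x\le y\to z$. A bounded residuated lattice also has a constant $\bot$ which is the least element; $\neg x:=x\to\bot$. An element $x$ is Boolean if $x\vee\neg x=\top$ and $x\wedge\neg x=\bot$; the Boolean elements form a subalgebra $\mathbf{B}(\mathbf{A})$ which is a Boolean algebra. Homomorphisms preserve all operations and constants. -}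

module Defs where

open import Level using (Level; suc)
open import Relation.Binary.PropositionalEquality using (_≡_)
open import Data.Product using (_×_)
open import Algebra.Structures using (IsCommutativeMonoid)
open import Algebra.Lattice.Structures using (IsLattice)

record BoundedResiduatedLattice (a : Level) : Set (suc a) where
  infixl 7 _∗_
  infixr 5 _⇒_
  infixr 6 _∨_
  infixr 7 _∧_
  infix 4 _≤_
  field
    Carrier : Set a
    _∗_ _⇒_ _∨_ _∧_ : Carrier → Carrier → Carrier
    ⊤ ⊥ : Carrier

  _≤_ : Carrier → Carrier → Set a
  x ≤ y = x ∧ y ≡ x

  field
    isCommutativeMonoid : IsCommutativeMonoid _≡_ _∗_ ⊤
    isLattice : IsLattice _≡_ _∨_ _∧_
    ⊤-top : ∀ x → x ≤ ⊤
    ⊥-bot : ∀ x → ⊥ ≤ x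
    residuated : ∀ x y z → (x ∗ y ≤ z → x ≤ y ⇒ z) × (x ≤ y ⇒ z → x ∗ y ≤ z)

  ¬_ : Carrier → Carrier
  ¬ x = x ⇒ ⊥

  IsBoolean : Carrier → Set a
  IsBoolean x = (x ∨ (¬ x) ≡ ⊤) × (x ∧ (¬ x) ≡ ⊥)

-- A homomorphism h : A → B(A): a map into the Boolean elements of A that
-- preserves all operations and constants (B(A) is a subalgebra of A).
record HomToBoolean {a : Level} (A : BoundedResiduatedLattice a) : Set a where
  open BoundedResiduatedLattice A
  field
    h : Carrier → Carrier
    h-boolean : ∀ x → IsBoolean (h x)
    h-∗ : ∀ x y → h (x ∗ y) ≡ h x ∗ h y
    h-⇒ : ∀ x y → h (x ⇒ y) ≡ h x ⇒ h y
    h-∨ : ∀ x y → h (x ∨ y) ≡ h x ∨ h y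
    h-∧ : ∀ x y → h (x ∧ y) ≡ h x ∧ h y
    h-⊤ : h ⊤ ≡ ⊤
    h-⊥ : h ⊥ ≡ ⊥

module Submission where

open import Defs
open import Level using (Level)
open import Data.Product using (proj₁; proj₂)
open import Relation.Binary.PropositionalEquality
  using (_≡_; refl; sym; trans; cong; isEquivalence)
open import Relation.Binary.Bundles using (Poset)
open import Algebra.Structures using (IsCommutativeMonoid)
open import Algebra.Lattice.Bundles using (Lattice)
import Algebra.Lattice.Properties.Lattice as LatticeProperties
import Relation.Binary.Lattice.Structures as OrderTheoretic
import Relation.Binary.Reasoning.PartialOrder as ≤-Reasoning

-- ¬¬x ≤ ¬¬(h x) ≤ h x because h x is Boolean, and h x ∗ ¬x ≤ h x ∗ ¬(h x) ≤ ⊥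
-- because ¬x ≤ h(¬x) = ¬(h x).

module ResiduatedLatticeProperties {a : Level} (A : BoundedResiduatedLattice a) where

  open BoundedResiduatedLattice A
  open IsCommutativeMonoid isCommutativeMonoid using (comm; identityˡ; identityʳ)

  lattice : Lattice a a
  lattice = record { isLattice = isLattice }

  -- The library orders a lattice by x ≈ x ∧ y, the mirror image of _≤_.
  private
    module Order = OrderTheoretic.IsLattice
      (LatticeProperties.∨-∧-isOrderTheoreticLattice lattice)

  ≤-refl : ∀ {x} → x ≤ x
  ≤-refl = sym Order.refl

  ≤-trans : ∀ {x y z} → x ≤ y → y ≤ z → x ≤ z
  ≤-trans x≤y y≤z = sym (Order.trans (sym x≤y) (sym y≤z))

  ≤-antisym : ∀ {x y} → x ≤ y → y ≤ x → x ≡ y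
  ≤-antisym x≤y y≤x = Order.antisym (sym x≤y) (sym y≤x)

  ∨-least : ∀ {x y z} → x ≤ z → y ≤ z → x ∨ y ≤ z
  ∨-least x≤z y≤z = sym (Order.∨-least (sym x≤z) (sym y≤z))

  poset : Poset a a a
  poset = record
    { _≤_ = _≤_
    ; isPartialOrder = record
      { isPreorder = record
        { isEquivalence = isEquivalence
        ; reflexive = λ { refl → ≤-refl }
        ; trans = ≤-trans
        }
      ; antisym = ≤-antisym
      }
    }

  open ≤-Reasoning poset

  residual-intro : ∀ {x y z} → x ∗ y ≤ z → x ≤ y ⇒ z
  residual-intro {x} {y} {z} = proj₁ (residuated x y z)

  residual-elim : ∀ {x y z} → x ≤ y ⇒ z → x ∗ y ≤ z
  residual-elim {x} {y} {z} = proj₂ (residuated x y z)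

  ∗-monoˡ-≤ : ∀ z {x y} → x ≤ y → x ∗ z ≤ y ∗ z
  ∗-monoˡ-≤ z x≤y = residual-elim (≤-trans x≤y (residual-intro ≤-refl))

  ∗-monoʳ-≤ : ∀ z {x y} → x ≤ y → z ∗ x ≤ z ∗ y
  ∗-monoʳ-≤ z {x} {y} x≤y = begin
    z ∗ x  ≡⟨ comm z x ⟩
    x ∗ z  ≤⟨ ∗-monoˡ-≤ z x≤y ⟩
    y ∗ z  ≡⟨ comm y z ⟩
    z ∗ y  ∎

  x∗y≤x : ∀ x y → x ∗ y ≤ x
  x∗y≤x x y = begin
    x ∗ y  ≤⟨ ∗-monoʳ-≤ x (⊤-top y) ⟩
    x ∗ ⊤  ≡⟨ identityʳ x ⟩
    x      ∎

  ¬x∗x≤⊥ : ∀ x → ¬ x ∗ x ≤ ⊥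
  ¬x∗x≤⊥ x = residual-elim ≤-refl

  ¬-antitone : ∀ {x y} → x ≤ y → ¬ y ≤ ¬ x
  ¬-antitone {x} {y} x≤y = residual-intro (begin
    ¬ y ∗ x  ≤⟨ ∗-monoʳ-≤ (¬ y) x≤y ⟩
    ¬ y ∗ y  ≤⟨ ¬x∗x≤⊥ y ⟩
    ⊥        ∎)

  ¬≤¬⇒≤¬¬ : ∀ {x y} → ¬ x ≤ ¬ y → y ≤ ¬ ¬ x
  ¬≤¬⇒≤¬¬ {x} {y} ¬x≤¬y = residual-intro (begin
    y ∗ ¬ x  ≤⟨ ∗-monoʳ-≤ y ¬x≤¬y ⟩
    y ∗ ¬ y  ≡⟨ comm y (¬ y) ⟩
    ¬ y ∗ y  ≤⟨ ¬x∗x≤⊥ y ⟩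
    ⊥        ∎)

  -- Both disjuncts of ⊤ = b ∨ ¬b lie below ¬¬b ⇒ b.
  ∨¬≡⊤⇒¬¬≤ : ∀ {b} → b ∨ ¬ b ≡ ⊤ → ¬ ¬ b ≤ b
  ∨¬≡⊤⇒¬¬≤ {b} b∨¬b≡⊤ = begin
    ¬ ¬ b      ≡⟨ identityˡ (¬ ¬ b) ⟨
    ⊤ ∗ ¬ ¬ b  ≤⟨ residual-elim ⊤≤¬¬b⇒b ⟩
    b          ∎
    where
    ¬b≤¬¬b⇒b : ¬ b ≤ ¬ ¬ b ⇒ b
    ¬b≤¬¬b⇒b = residual-intro (begin
      ¬ b ∗ ¬ ¬ b  ≡⟨ comm (¬ b) (¬ ¬ b) ⟩
      ¬ ¬ b ∗ ¬ b  ≤⟨ ¬x∗x≤⊥ (¬ b) ⟩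
      ⊥            ≤⟨ ⊥-bot b ⟩
      b            ∎)

    ⊤≤¬¬b⇒b : ⊤ ≤ ¬ ¬ b ⇒ b
    ⊤≤¬¬b⇒b = begin
      ⊤           ≡⟨ b∨¬b≡⊤ ⟨
      b ∨ ¬ b     ≤⟨ ∨-least (residual-intro (x∗y≤x b (¬ ¬ b))) ¬b≤¬¬b⇒b ⟩
      ¬ ¬ b ⇒ b   ∎

module _ {a : Level} {A : BoundedResiduatedLattice a} (H : HomToBoolean A) where

  open BoundedResiduatedLattice A
  open HomToBoolean H

  h-¬ : ∀ x → h (¬ x) ≡ ¬ h x
  h-¬ x = trans (h-⇒ x ⊥) (cong (h x ⇒_) h-⊥)

lemma3p1 : {a : Level} (A : BoundedResiduatedLattice a) (H : HomToBoolean A) →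
    let open BoundedResiduatedLattice A
        open HomToBoolean H
    in (∀ x → h (h x) ≡ h x) → (∀ x → x ≤ h x) → ∀ x → ¬ (¬ x) ≡ h x
lemma3p1 A H _ x≤hx x = ≤-antisym ¬¬x≤hx hx≤¬¬x
  where
  open BoundedResiduatedLattice A
  open HomToBoolean H
  open ResiduatedLatticeProperties A
  open ≤-Reasoning poset

  ¬¬x≤hx : ¬ ¬ x ≤ h x
  ¬¬x≤hx = begin
    ¬ ¬ x      ≤⟨ ¬-antitone (¬-antitone (x≤hx x)) ⟩
    ¬ ¬ h x    ≤⟨ ∨¬≡⊤⇒¬¬≤ (proj₁ (h-boolean x)) ⟩
    h x        ∎

  hx≤¬¬x : h x ≤ ¬ ¬ x
  hx≤¬¬x = ¬≤¬⇒≤¬¬ (begin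
    ¬ x        ≤⟨ x≤hx (¬ x) ⟩
    h (¬ x)    ≡⟨ h-¬ H x ⟩
    ¬ h x      ∎)
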